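{- Let $a,b$ be positive integers with $a+b=5$, and let $m,s$ be positive integers. Then there exists a magic rectangle $MR(am,bm;bs,as)$ if and only if $s$ is even and $2\leq s\leq m$.
   Context: For positive integers $m,n,r,s$ with $mr=ns$, $r\le n$, $s\le m$, a magic rectangle $MR(m,n;r,s)$ is an $m\times n$ array in which some cells may be empty, each row contains exactly $r$ filled cells, each column contains exactly $s$ filled cells, the filled cells contain the numbers $0,1,\ldots,mr-1$, each exactly once, the sum of the entries of each row is the same for all rows, and the sum of the entries of each column is the same for all columns. -}

module Defs where

open import Data.Nat using (ℕ; zero; suc; _+_; _*_; _<_)
open import Data.Fin using (Fin)
open import Data.Maybe using (Maybe; just; nothing)
open import Data.Product using (_×_; Σ; ∃; ∃-syntax; _,_)
open import Relation.Binary.PropositionalEquality using (_≡_)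
open import Data.Vec.Functional using (foldr)

Σℕ : {k : ℕ} → (Fin k → ℕ) → ℕ
Σℕ f = foldr _+_ 0 f

filled : Maybe ℕ → ℕ
filled (just _) = 1
filled nothing  = 0

entry : Maybe ℕ → ℕ
entry (just x) = x
entry nothing  = 0

Array : ℕ → ℕ → Set
Array m n = Fin m → Fin n → Maybe ℕ

record IsMagicRectangle (m n r s : ℕ) (A : Array m n) : Set where
  field
    rowFilled : ∀ i → Σℕ (λ j → filled (A i j)) ≡ r
    colFilled : ∀ j → Σℕ (λ i → filled (A i j)) ≡ s
    entries<  : ∀ i j x → A i j ≡ just x → x < m * r
    occurs    : ∀ x → x < m * r → ∃[ i ] ∃[ j ] (A i j ≡ just x)
    once      : ∀ i j i′ j′ x → A i j ≡ just x → A i′ j′ ≡ just x →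
                (i ≡ i′) × (j ≡ j′)
    rowSums   : ∀ i i′ → Σℕ (λ j → entry (A i j)) ≡ Σℕ (λ j → entry (A i′ j))
    colSums   : ∀ j j′ → Σℕ (λ i → entry (A i j)) ≡ Σℕ (λ i → entry (A i j′))

MR : ℕ → ℕ → ℕ → ℕ → Set
MR m n r s = Σ (Array m n) (IsMagicRectangle m n r s)

-- The entries 0, …, N − 1 of an MR(m, n; r, s) sum to N(N − 1)/2 with N = mr, and this total is
-- m times the row sum R, so 2R + r = r·N after cancelling m: if N is even then so is r, and
-- likewise s. For a + b = 5 the number of entries ab·ms is even, so bs and as are even; since one
-- of a, b is odd, s is even, and s ≤ m because a row has bm cells.
--
-- Conversely, take a odd and b = 2c even (the other case is the transpose) and split the array
-- into an m × m grid of a × b blocks, filling block (I, J) exactly when its cyclic offset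
-- d = J − I mod m is below s = 2t; then every block row and block column holds s filled blocks.
-- A cell of a filled block gets the numeral with digits (y, X, k) in the mixed radix (2m, ab, t):
-- X is the position of the cell inside its block, k = d and y = J, except that in the right half
-- of the block J is replaced by its mirror image m − 1 − J. Blocks of offset t + k carry the
-- digit-wise complements y ↦ 2m − 1 − y, X ↦ ab − 1 − X of the blocks of offset k. Entries of
-- complementary blocks sum to a constant, and each block row segment contains J and m − 1 − J
-- equally often, so all row sums agree and all column sums agree; decoding the digits locates
-- every number in exactly one cell.

module Submission where

open import Defs
open import Data.Nat
open import Data.Nat.Properties
open import Algebra.Properties.CommutativeMonoid.Sum +-0-commutativeMonoid
  using (sum-cong-≗; ∑-comm; ∑-distrib-+; sum-remove)
import Data.Bool as Bool
open Bool using (T; true; false)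
open import Data.Fin using (Fin; toℕ; fromℕ<; zero; suc; punchIn)
open import Data.Fin.Properties using (punchInᵢ≢i; toℕ<n; toℕ-fromℕ<; toℕ-injective)
open import Data.Maybe using (Maybe; just; nothing)
open import Data.Maybe.Properties using (just-injective)
open import Data.Nat.DivMod
open import Data.Nat.Divisibility
  using (_∣_; divides; _∣?_; ∣⇒≤; ∣m⇒∣m*n; ∣m+n∣m⇒∣n; ∣n⇒∣m*n; n∣m*n)
open import Data.Nat.Primality using (euclidsLemma; prime[2])
open import Data.Nat.Tactic.RingSolver using (solve-∀)
open import Data.Product using (_×_; _,_; proj₁; proj₂; ∃-syntax; uncurry)
open import Data.Sum using ([_,_]′)
open import Function using (_∘_; id; _⇔_; mk⇔)
open import Function.Construct.Composition using (_⇔-∘_)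
open import Relation.Binary.PropositionalEquality
  using (_≡_; _≢_; refl; sym; trans; cong; cong₂; subst; module ≡-Reasoning)
open import Relation.Nullary using (¬_; yes; no; contradiction)
open import Relation.Nullary.Decidable using (from-no)
open ≡-Reasoning

cong₃ : {A B C D : Set} (f : A → B → C → D) {x x′ : A} {y y′ : B} {z z′ : C} →
        x ≡ x′ → y ≡ y′ → z ≡ z′ → f x y z ≡ f x′ y′ z′
cong₃ f refl refl refl = refl

infix 0 if_<_then_else_

-- Through the boolean test _<ᵇ_ rather than _<?_, so that goals mentioning a conditional stay
-- small and are not unfolded into the decision procedure.
if_<_then_else_ : {A : Set} → ℕ → ℕ → A → A → A
if d < t then x else y = Bool.if (d <ᵇ t) then x else y

<-≥-cases : {G : Set} (d t : ℕ) → (d < t → G) → (t ≤ d → G) → G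
<-≥-cases d t on-< on-≥ with d <? t
... | yes d<t = on-< d<t
... | no d≮t  = on-≥ (≮⇒≥ d≮t)

module _ {A : Set} {d t : ℕ} {x y : A} where

  if-< : d < t → (if d < t then x else y) ≡ x
  if-< d<t = select-true (<⇒<ᵇ d<t)
    where
    select-true : ∀ {b} → T b → (Bool.if b then x else y) ≡ x
    select-true {true} _ = refl

  if-≥ : t ≤ d → (if d < t then x else y) ≡ y
  if-≥ t≤d = select-false (λ d<ᵇt → <⇒≱ (<ᵇ⇒< d t d<ᵇt) t≤d)
    where
    select-false : ∀ {b} → ¬ T b → (Bool.if b then x else y) ≡ y
    select-false {false} _  = refl
    select-false {true} ¬tt = contradiction _ ¬tt

if-elim : {A : Set} {x y : A} (P : A → Set) (d t : ℕ) →
          (d < t → P x) → (t ≤ d → P y) → P (if d < t then x else y)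
if-elim P d t on-< on-≥ = <-≥-cases d t
  (λ d<t → subst P (sym (if-< d<t)) (on-< d<t))
  (λ t≤d → subst P (sym (if-≥ t≤d)) (on-≥ t≤d))

if-map : {A B : Set} (φ : A → B) (d t : ℕ) (x y : A) →
         φ (if d < t then x else y) ≡ (if d < t then φ x else φ y)
if-map φ d t x y with d <ᵇ t
... | true  = refl
... | false = refl

if-just : ∀ {d s} {v x : ℕ} → (if d < s then just v else nothing) ≡ just x → (d < s) × (v ≡ x)
if-just {d} {s} {v} {x} = if-elim (λ u → u ≡ just x → (d < s) × (v ≡ x)) d s
  (λ d<s v≡x → d<s , just-injective v≡x)
  (λ _ ())

-- Finite sums

Σℕ-const : ∀ {k} c → Σℕ {k} (λ _ → c) ≡ k * c
Σℕ-const {zero}  c = refl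
Σℕ-const {suc k} c = cong (c +_) (Σℕ-const {k} c)

Σℕ-zero : ∀ {k} {f : Fin k → ℕ} → (∀ i → f i ≡ 0) → Σℕ f ≡ 0
Σℕ-zero {k} f≡0 = trans (sum-cong-≗ f≡0) (trans (Σℕ-const {k} 0) (*-zeroʳ k))

Σℕ-single : ∀ {k} {f : Fin k → ℕ} i → (∀ j → j ≢ i → f j ≡ 0) → Σℕ f ≡ f i
Σℕ-single {suc k} {f} i f≡0 = begin
  Σℕ f                                ≡⟨ sum-remove f ⟩
  f i + Σℕ (λ j → f (punchIn i j))    ≡⟨ cong (f i +_) (Σℕ-zero (λ j → f≡0 _ (punchInᵢ≢i i j))) ⟩
  f i + 0                             ≡⟨ +-identityʳ (f i) ⟩
  f i                                 ∎

Σℕ-≤ : ∀ {k} {f : Fin k → ℕ} → (∀ i → f i ≤ 1) → Σℕ f ≤ k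
Σℕ-≤ {zero}  f≤1 = z≤n
Σℕ-≤ {suc k} f≤1 = +-mono-≤ (f≤1 zero) (Σℕ-≤ (λ i → f≤1 (suc i)))

Σℕ-toℕ-gauss : ∀ n → Σℕ {n} toℕ * 2 + n ≡ n * n
Σℕ-toℕ-gauss zero    = refl
Σℕ-toℕ-gauss (suc n) = begin
  Σℕ {n} (λ i → 1 + toℕ i) * 2 + suc n
    ≡⟨ cong (λ z → z * 2 + suc n) (∑-distrib-+ {n} (λ _ → 1) toℕ) ⟩
  (Σℕ {n} (λ _ → 1) + S) * 2 + suc n
    ≡⟨ cong (λ z → (z + S) * 2 + suc n) (trans (Σℕ-const {n} 1) (*-identityʳ n)) ⟩
  (n + S) * 2 + suc n
    ≡⟨ regroup n S ⟩
  (S * 2 + n) + 2 * n + 1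
    ≡⟨ cong (λ z → z + 2 * n + 1) (Σℕ-toℕ-gauss n) ⟩
  n * n + 2 * n + 1
    ≡⟨ square n ⟩
  suc n * suc n ∎
  where
  S : ℕ
  S = Σℕ {n} toℕ
  regroup : ∀ n S → (n + S) * 2 + suc n ≡ (S * 2 + n) + 2 * n + 1
  regroup = solve-∀
  square : ∀ n → n * n + 2 * n + 1 ≡ suc n * suc n
  square = solve-∀

sumTo : ℕ → (ℕ → ℕ) → ℕ
sumTo zero    f = 0
sumTo (suc k) f = f 0 + sumTo k (λ n → f (suc n))

Σℕ-toℕ-sumTo : ∀ k (f : ℕ → ℕ) → Σℕ {k} (λ i → f (toℕ i)) ≡ sumTo k f
Σℕ-toℕ-sumTo zero    f = refl
Σℕ-toℕ-sumTo (suc k) f = cong (f 0 +_) (Σℕ-toℕ-sumTo k (λ n → f (suc n)))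

sumTo-cong : ∀ k {f g : ℕ → ℕ} → (∀ n → n < k → f n ≡ g n) → sumTo k f ≡ sumTo k g
sumTo-cong zero    f≡g = refl
sumTo-cong (suc k) f≡g = cong₂ _+_ (f≡g 0 z<s) (sumTo-cong k (λ n n<k → f≡g (suc n) (s<s n<k)))

sumTo-const : ∀ k c → sumTo k (λ _ → c) ≡ k * c
sumTo-const zero    c = refl
sumTo-const (suc k) c = cong (c +_) (sumTo-const k c)

sumTo-zero : ∀ k {f : ℕ → ℕ} → (∀ n → n < k → f n ≡ 0) → sumTo k f ≡ 0
sumTo-zero k f≡0 = trans (sumTo-cong k f≡0) (trans (sumTo-const k 0) (*-zeroʳ k))

sumTo-+ : ∀ k (f g : ℕ → ℕ) → sumTo k (λ n → f n + g n) ≡ sumTo k f + sumTo k g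
sumTo-+ zero    f g = refl
sumTo-+ (suc k) f g = trans (cong (f 0 + g 0 +_) (sumTo-+ k _ _)) (swap-middle (f 0) (g 0) _ _)
  where
  swap-middle : ∀ w x y z → w + x + (y + z) ≡ w + y + (x + z)
  swap-middle = solve-∀

sumTo-split : ∀ k l (f : ℕ → ℕ) → sumTo (k + l) f ≡ sumTo k f + sumTo l (λ n → f (k + n))
sumTo-split zero    l f = refl
sumTo-split (suc k) l f =
  trans (cong (f 0 +_) (sumTo-split k l (λ n → f (suc n)))) (sym (+-assoc (f 0) _ _))

sumTo-last : ∀ k (f : ℕ → ℕ) → sumTo (suc k) f ≡ sumTo k f + f k
sumTo-last zero    f = +-comm (f 0) 0
sumTo-last (suc k) f = trans (cong (f 0 +_) (sumTo-last k (λ n → f (suc n)))) (sym (+-assoc (f 0) _ _))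

sumTo-reverse : ∀ k (f : ℕ → ℕ) → sumTo k (λ n → f (k ∸ suc n)) ≡ sumTo k f
sumTo-reverse zero    f = refl
sumTo-reverse (suc k) f =
  trans (cong (f k +_) (sumTo-reverse k f)) (trans (+-comm (f k) _) (sym (sumTo-last k f)))

sumTo-halves : ∀ t (f : ℕ → ℕ) → sumTo (t + t) f ≡ sumTo t (λ k → f k + f (t + k))
sumTo-halves t f = trans (sumTo-split t t f) (sym (sumTo-+ t f (λ k → f (t + k))))

sumTo-truncate : ∀ {s m} (f : ℕ → ℕ) → s ≤ m → (∀ n → s ≤ n → f n ≡ 0) → sumTo m f ≡ sumTo s f
sumTo-truncate {s} {m} f s≤m f≡0 = begin
  sumTo m f
    ≡⟨ cong (λ k → sumTo k f) (sym (m+[n∸m]≡n s≤m)) ⟩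
  sumTo (s + (m ∸ s)) f
    ≡⟨ sumTo-split s (m ∸ s) f ⟩
  sumTo s f + sumTo (m ∸ s) (λ n → f (s + n))
    ≡⟨ cong (sumTo s f +_) (sumTo-zero (m ∸ s) (λ n _ → f≡0 (s + n) (m≤m+n s n))) ⟩
  sumTo s f + 0
    ≡⟨ +-identityʳ _ ⟩
  sumTo s f ∎

sumTo-if : ∀ n d s (f : ℕ → ℕ) →
           sumTo n (λ q → if d < s then f q else 0) ≡ (if d < s then sumTo n f else 0)
sumTo-if n d s f = if-elim (λ v → sumTo n (λ q → if d < s then f q else 0) ≡ v) d s
  (λ d<s → sumTo-cong n (λ q _ → if-< d<s))
  (λ s≤d → sumTo-zero n (λ q _ → if-≥ s≤d))

sumTo-guard : ∀ {s m} (g : ℕ → ℕ) → s ≤ m → sumTo m (λ d → if d < s then g d else 0) ≡ sumTo s g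
sumTo-guard {s} g s≤m =
  trans (sumTo-truncate _ s≤m (λ _ s≤d → if-≥ s≤d)) (sumTo-cong s (λ _ d<s → if-< d<s))

sumTo-blocks : ∀ m b (f : ℕ → ℕ) → sumTo (m * b) f ≡ sumTo m (λ J → sumTo b (λ q → f (q + J * b)))
sumTo-blocks zero    b f = refl
sumTo-blocks (suc m) b f = trans (sumTo-split b (m * b) f)
  (cong₂ _+_ (sumTo-cong b (λ q _ → cong f (sym (+-identityʳ q))))
             (trans (sumTo-blocks m b (λ n → f (b + n)))
                    (sumTo-cong m (λ J _ → sumTo-cong b (λ q _ → cong f (shift q J))))))
  where
  shift : ∀ q J → b + (q + J * b) ≡ q + (b + J * b)
  shift q J = trans (sym (+-assoc b q _)) (trans (cong (_+ J * b) (+-comm b q)) (+-assoc q b _))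

mixed-radix-< : ∀ {r q n K} → r < n → q < K → r + q * n < K * n
mixed-radix-< {q = q} {n} r<n q<K = ≤-trans (+-monoˡ-< (q * n) r<n) (*-monoˡ-≤ n q<K)

divmod-unique : ∀ {r n} q .{{_ : NonZero n}} → r < n → ((r + q * n) / n ≡ q) × ((r + q * n) % n ≡ r)
divmod-unique {r} {n} q r<n =
  trans (+-distrib-/-∣ʳ r (divides q refl)) (cong₂ _+_ (m<n⇒m/n≡0 r<n) (m*n/n≡m q n)) ,
  trans ([m+kn]%n≡m%n r q n) (m<n⇒m%n≡m r<n)

Σℕ-blocks : ∀ b m .{{_ : NonZero b}} (g : ℕ → ℕ → ℕ) →
            Σℕ {b * m} (λ j → g (toℕ j / b) (toℕ j % b)) ≡ sumTo m (λ J → sumTo b (g J))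
Σℕ-blocks b m g = begin
  Σℕ {b * m} (λ j → g (toℕ j / b) (toℕ j % b))
    ≡⟨ Σℕ-toℕ-sumTo (b * m) _ ⟩
  sumTo (b * m) (λ n → g (n / b) (n % b))
    ≡⟨ cong (λ k → sumTo k (λ n → g (n / b) (n % b))) (*-comm b m) ⟩
  sumTo (m * b) (λ n → g (n / b) (n % b))
    ≡⟨ sumTo-blocks m b _ ⟩
  sumTo m (λ J → sumTo b (λ q → g ((q + J * b) / b) ((q + J * b) % b)))
    ≡⟨ sumTo-cong m (λ J _ → sumTo-cong b (λ q q<b → uncurry (cong₂ g) (divmod-unique J q<b))) ⟩
  sumTo m (λ J → sumTo b (g J)) ∎

-- Necessary conditions

count : ℕ → Maybe ℕ → ℕ
count x nothing = 0
count x (just y) with y ≟ x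
... | yes _ = 1
... | no _  = 0

count-self : ∀ x → count x (just x) ≡ 1
count-self x with x ≟ x
... | yes _   = refl
... | no x≢x = contradiction refl x≢x

count-≢ : ∀ x y → y ≢ x → count x (just y) ≡ 0
count-≢ x y y≢x with y ≟ x
... | yes y≡x = contradiction y≡x y≢x
... | no _    = refl

entry-as-sum : ∀ N v → (∀ y → v ≡ just y → y < N) →
               entry v ≡ Σℕ {N} (λ x → toℕ x * count (toℕ x) v)
entry-as-sum N nothing  _    = sym (Σℕ-zero {N} (λ x → *-zeroʳ (toℕ x)))
entry-as-sum N (just y) y<N = sym (begin
  Σℕ {N} (λ x → toℕ x * count (toℕ x) (just y))  ≡⟨ Σℕ-single (fromℕ< y<) others ⟩
  toℕ (fromℕ< y<) * count _ (just y)         ≡⟨ cong (λ z → z * count z (just y)) (toℕ-fromℕ< y<) ⟩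
  y * count y (just y)                        ≡⟨ cong (y *_) (count-self y) ⟩
  y * 1                                       ≡⟨ *-identityʳ y ⟩
  y                                           ∎)
  where
  y< : y < N
  y< = y<N y refl
  others : ∀ x → x ≢ fromℕ< y< → toℕ x * count (toℕ x) (just y) ≡ 0
  others x x≢y = trans (cong (toℕ x *_) (count-≢ (toℕ x) y y≢x)) (*-zeroʳ (toℕ x))
    where
    y≢x : y ≢ toℕ x
    y≢x y≡x = x≢y (toℕ-injective (trans (sym y≡x) (sym (toℕ-fromℕ< y<))))

module _ {m n r s} {A : Array m n} (H : IsMagicRectangle m n r s A) where
  open IsMagicRectangle H

  private
    total : ℕ
    total = Σℕ (λ i → Σℕ (λ j → entry (A i j)))

    row₀ : .{{_ : NonZero m}} → Fin m
    row₀ = fromℕ< (>-nonZero⁻¹ m)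

    weighted-count : (x : Fin (m * r)) →
                     Σℕ (λ i → Σℕ (λ j → toℕ x * count (toℕ x) (A i j))) ≡ toℕ x
    weighted-count x with occurs (toℕ x) (toℕ<n x)
    ... | i₀ , j₀ , A₀≡x = begin
      Σℕ (λ i → Σℕ (λ j → f i j))
        ≡⟨ Σℕ-single i₀ (λ i i≢i₀ → Σℕ-zero (λ j → f-zero (i≢i₀ ∘ proj₁ ∘ once′ i j))) ⟩
      Σℕ (λ j → f i₀ j)
        ≡⟨ Σℕ-single j₀ (λ j j≢j₀ → f-zero (j≢j₀ ∘ proj₂ ∘ once′ i₀ j)) ⟩
      toℕ x * count (toℕ x) (A i₀ j₀)
        ≡⟨ cong (λ v → toℕ x * count (toℕ x) v) A₀≡x ⟩
      toℕ x * count (toℕ x) (just (toℕ x))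
        ≡⟨ cong (toℕ x *_) (count-self (toℕ x)) ⟩
      toℕ x * 1
        ≡⟨ *-identityʳ (toℕ x) ⟩
      toℕ x ∎
      where
      f : Fin m → Fin n → ℕ
      f i j = toℕ x * count (toℕ x) (A i j)
      once′ : ∀ i j → A i j ≡ just (toℕ x) → (i ≡ i₀) × (j ≡ j₀)
      once′ i j Aij≡x = once i j i₀ j₀ (toℕ x) Aij≡x A₀≡x
      f-zero : ∀ {i j} → ¬ A i j ≡ just (toℕ x) → f i j ≡ 0
      f-zero {i} {j} Aij≢x with A i j
      ... | nothing = *-zeroʳ (toℕ x)
      ... | just y  = trans (cong (toℕ x *_) (count-≢ (toℕ x) y (Aij≢x ∘ cong just))) (*-zeroʳ (toℕ x))

  total-entries : total ≡ Σℕ {m * r} toℕ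
  total-entries = begin
    Σℕ (λ i → Σℕ (λ j → entry (A i j)))
      ≡⟨ sum-cong-≗ (λ i → sum-cong-≗ (λ j → entry-as-sum (m * r) (A i j) (entries< i j))) ⟩
    Σℕ (λ i → Σℕ (λ j → Σℕ (λ x → g x i j)))
      ≡⟨ sum-cong-≗ (λ i → ∑-comm (λ j x → g x i j)) ⟩
    Σℕ (λ i → Σℕ (λ x → Σℕ (λ j → g x i j)))
      ≡⟨ ∑-comm (λ i x → Σℕ (λ j → g x i j)) ⟩
    Σℕ (λ x → Σℕ (λ i → Σℕ (λ j → g x i j)))
      ≡⟨ sum-cong-≗ weighted-count ⟩
    Σℕ {m * r} toℕ ∎
    where
    g : Fin (m * r) → Fin m → Fin n → ℕ
    g x i j = toℕ x * count (toℕ x) (A i j)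

  total-by-rows : ∀ i₀ → total ≡ m * Σℕ (λ j → entry (A i₀ j))
  total-by-rows i₀ = trans (sum-cong-≗ (λ i → rowSums i i₀)) (Σℕ-const {m} _)

  row-length-≤ : .{{_ : NonZero m}} → r ≤ n
  row-length-≤ = subst (_≤ n) (rowFilled row₀) (Σℕ-≤ (λ j → filled≤1 (A row₀ j)))
    where
    filled≤1 : ∀ v → filled v ≤ 1
    filled≤1 (just _) = s≤s z≤n
    filled≤1 nothing  = z≤n

  row-length-even : .{{_ : NonZero m}} → 2 ∣ m * r → 2 ∣ r
  row-length-even 2∣mr = ∣m+n∣m⇒∣n (subst (2 ∣_) (sym halved) (∣n⇒∣m*n r 2∣mr)) (n∣m*n R)
    where
    R : ℕ
    R = Σℕ (λ j → entry (A row₀ j))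
    halved : R * 2 + r ≡ r * (m * r)
    halved = *-cancelˡ-≡ _ _ m (begin
      m * (R * 2 + r)          ≡⟨ *-distribˡ-+ m (R * 2) r ⟩
      m * (R * 2) + m * r      ≡⟨ cong (_+ m * r) (sym (*-assoc m R 2)) ⟩
      m * R * 2 + m * r        ≡⟨ cong (λ T → T * 2 + m * r) (trans (sym (total-by-rows row₀)) total-entries) ⟩
      Σℕ {m * r} toℕ * 2 + m * r ≡⟨ Σℕ-toℕ-gauss (m * r) ⟩
      m * r * (m * r)          ≡⟨ *-assoc m r (m * r) ⟩
      m * (r * (m * r))        ∎)

transpose : ∀ {m n r s} {A : Array m n} → m * r ≡ n * s →
            IsMagicRectangle m n r s A → IsMagicRectangle n m s r (λ j i → A i j)
transpose mr≡ns H = record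
  { rowFilled = colFilled
  ; colFilled = rowFilled
  ; entries<  = λ j i x A≡x → subst (x <_) mr≡ns (entries< i j x A≡x)
  ; occurs    = λ x x< → let (i , j , A≡x) = occurs x (subst (x <_) (sym mr≡ns) x<) in j , i , A≡x
  ; once      = λ j i j′ i′ x A≡x A′≡x →
      let (i≡ , j≡) = once i j i′ j′ x A≡x A′≡x in j≡ , i≡
  ; rowSums   = colSums
  ; colSums   = rowSums
  }
  where open IsMagicRectangle H

MR-transpose : ∀ {m n r s} → m * r ≡ n * s → MR m n r s → MR n m s r
MR-transpose mr≡ns (A , H) = (λ j i → A i j) , transpose mr≡ns H

-- The construction

-- m × m blocks of a = a′ + 1 rows and b = 2c columns, of which s = 2t ≤ m are filled in every
-- block row and block column.
module Construction (a′ c′ m′ t′ : ℕ) (s≤m : suc t′ + suc t′ ≤ suc m′) where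

  a c m t : ℕ
  a = suc a′
  c = suc c′
  m = suc m′
  t = suc t′

  b s ab 2m : ℕ
  b  = c + c
  s  = t + t
  ab = a * b
  2m = m + m

  <m⇒≤m′ : ∀ {J} → J < m → J ≤ m′
  <m⇒≤m′ = s≤s⁻¹

  _⊖_ : ℕ → ℕ → ℕ
  J ⊖ d = if J < d then m ∸ (d ∸ J) else J ∸ d

  ⊖<m : ∀ {J d} → J < m → d < m → J ⊖ d < m
  ⊖<m {J} {d} J<m d<m = if-elim (_< m) J d
    (λ J<d → ∸-monoʳ-< (m<n⇒0<n∸m J<d) (≤-trans (m∸n≤m d J) (<⇒≤ d<m)))
    (λ _ → ≤-<-trans (m∸n≤m J d) J<m)

  ⊖-cancel : ∀ {J d} → J < m → d < m → J ⊖ (J ⊖ d) ≡ d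
  ⊖-cancel {J} {d} J<m d<m = if-elim (λ x → J ⊖ x ≡ d) J d wrapped unwrapped
    where
    wrapped : J < d → J ⊖ (m ∸ (d ∸ J)) ≡ d
    wrapped J<d = begin
      J ⊖ (m ∸ (d ∸ J))       ≡⟨ if-< J<m∸[d∸J] ⟩
      m ∸ (m ∸ (d ∸ J) ∸ J)   ≡⟨ cong (m ∸_) (∸-+-assoc m (d ∸ J) J) ⟩
      m ∸ (m ∸ (d ∸ J + J))   ≡⟨ cong (λ z → m ∸ (m ∸ z)) (m∸n+n≡m (<⇒≤ J<d)) ⟩
      m ∸ (m ∸ d)             ≡⟨ m∸[m∸n]≡n (<⇒≤ d<m) ⟩
      d                       ∎
      where
      J<m∸[d∸J] : J < m ∸ (d ∸ J)
      J<m∸[d∸J] = m+n≤o⇒m≤o∸n (suc J) (subst (_≤ m) (cong suc (sym (m+[n∸m]≡n (<⇒≤ J<d)))) d<m)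
    unwrapped : d ≤ J → J ⊖ (J ∸ d) ≡ d
    unwrapped d≤J = trans (if-≥ (m∸n≤m J d)) (m∸[m∸n]≡n d≤J)

  sumTo-rotate : ∀ {I} → I < m → (R : ℕ → ℕ) → sumTo m (λ J → R (J ⊖ I)) ≡ sumTo m R
  sumTo-rotate {I} I<m R = begin
    sumTo m (λ J → R (J ⊖ I))
      ≡⟨ cong (λ k → sumTo k (λ J → R (J ⊖ I))) (sym I+L≡m) ⟩
    sumTo (I + L) (λ J → R (J ⊖ I))
      ≡⟨ sumTo-split I L (λ J → R (J ⊖ I)) ⟩
    sumTo I (λ J → R (J ⊖ I)) + sumTo L (λ n → R ((I + n) ⊖ I))
      ≡⟨ cong₂ _+_ (sumTo-cong I wrapped) (sumTo-cong L unwrapped) ⟩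
    sumTo I (λ J → R (L + J)) + sumTo L R
      ≡⟨ +-comm (sumTo I (λ J → R (L + J))) _ ⟩
    sumTo L R + sumTo I (λ J → R (L + J))
      ≡⟨ sumTo-split L I R ⟨
    sumTo (L + I) R
      ≡⟨ cong (λ k → sumTo k R) (trans (+-comm L I) I+L≡m) ⟩
    sumTo m R ∎
    where
    L : ℕ
    L = m ∸ I
    I+L≡m : I + L ≡ m
    I+L≡m = m+[n∸m]≡n (<⇒≤ I<m)
    wrapped : ∀ J → J < I → R (J ⊖ I) ≡ R (L + J)
    wrapped J J<I = cong R (begin
      J ⊖ I                         ≡⟨ if-< J<I ⟩
      m ∸ (I ∸ J)                   ≡⟨ cong (_∸ (I ∸ J)) (sym L+J+[I∸J]≡m) ⟩
      L + J + (I ∸ J) ∸ (I ∸ J)     ≡⟨ m+n∸n≡m (L + J) (I ∸ J) ⟩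
      L + J                         ∎)
      where
      L+J+[I∸J]≡m : L + J + (I ∸ J) ≡ m
      L+J+[I∸J]≡m = begin
        L + J + (I ∸ J)   ≡⟨ +-assoc L J (I ∸ J) ⟩
        L + (J + (I ∸ J)) ≡⟨ cong (L +_) (m+[n∸m]≡n (<⇒≤ J<I)) ⟩
        L + I             ≡⟨ +-comm L I ⟩
        I + L             ≡⟨ I+L≡m ⟩
        m                 ∎
    unwrapped : ∀ n → n < L → R ((I + n) ⊖ I) ≡ R n
    unwrapped n _ = cong R (trans (if-≥ (m≤m+n I n)) (m+n∸m≡n I n))

  sumTo-reflect : ∀ {J} → J < m → (R : ℕ → ℕ) → sumTo m (λ I → R (J ⊖ I)) ≡ sumTo m R
  sumTo-reflect {J} J<m R = begin
    sumTo m (λ I → R (J ⊖ I))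
      ≡⟨ cong (λ k → sumTo k (λ I → R (J ⊖ I))) (sym J<L≡m) ⟩
    sumTo (suc J + L) (λ I → R (J ⊖ I))
      ≡⟨ sumTo-split (suc J) L (λ I → R (J ⊖ I)) ⟩
    sumTo (suc J) (λ I → R (J ⊖ I)) + sumTo L (λ n → R (J ⊖ (suc J + n)))
      ≡⟨ cong₂ _+_ (sumTo-cong (suc J) unwrapped) (sumTo-cong L wrapped) ⟩
    sumTo (suc J) (λ n → R (J ∸ n)) + sumTo L (λ n → R (suc J + (L ∸ suc n)))
      ≡⟨ cong₂ _+_ (sumTo-reverse (suc J) R) (sumTo-reverse L (λ n → R (suc J + n))) ⟩
    sumTo (suc J) R + sumTo L (λ n → R (suc J + n))
      ≡⟨ sumTo-split (suc J) L R ⟨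
    sumTo (suc J + L) R
      ≡⟨ cong (λ k → sumTo k R) J<L≡m ⟩
    sumTo m R ∎
    where
    L : ℕ
    L = m ∸ suc J
    J<L≡m : suc J + L ≡ m
    J<L≡m = m+[n∸m]≡n J<m
    unwrapped : ∀ I → I < suc J → R (J ⊖ I) ≡ R (J ∸ I)
    unwrapped I I<sJ = cong R (if-≥ (s≤s⁻¹ I<sJ))
    wrapped : ∀ n → n < L → R (J ⊖ (suc J + n)) ≡ R (suc J + (L ∸ suc n))
    wrapped n n<L = cong R (begin
      J ⊖ (suc J + n)           ≡⟨ if-< (s≤s (m≤m+n J n)) ⟩
      m ∸ (suc J + n ∸ J)       ≡⟨ cong (λ k → m ∸ (k ∸ J)) (sym (+-suc J n)) ⟩
      m ∸ (J + suc n ∸ J)       ≡⟨ cong (m ∸_) (m+n∸m≡n J (suc n)) ⟩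
      m ∸ suc n                 ≡⟨ cong (_∸ suc n) (sym J<L≡m) ⟩
      suc J + L ∸ suc n         ≡⟨ +-∸-assoc (suc J) n<L ⟩
      suc J + (L ∸ suc n)       ∎)

  mirror : ℕ → ℕ → ℕ
  mirror J q = if q < c then J else m′ ∸ J

  mirror-< : ∀ {J q} → q < c → mirror J q ≡ J
  mirror-< = if-<

  mirror-≥ : ∀ {J q} → c ≤ q → mirror J q ≡ m′ ∸ J
  mirror-≥ = if-≥

  mirror<m : ∀ {J} q → J < m → mirror J q < m
  mirror<m {J} q J<m = if-elim (_< m) q c (λ _ → J<m) (λ _ → s≤s (m∸n≤m m′ J))

  mirror-involutive : ∀ {J} q → J < m → mirror (mirror J q) q ≡ J
  mirror-involutive {J} q J<m = if-elim (λ w → mirror w q ≡ J) q c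
    (λ q<c → if-< q<c)
    (λ c≤q → trans (if-≥ c≤q) (m∸[m∸n]≡n (<m⇒≤m′ J<m)))

  sumTo-mirror : ∀ J (g : ℕ → ℕ) → sumTo b (λ q → g (mirror J q)) ≡ c * (g J + g (m′ ∸ J))
  sumTo-mirror J g = begin
    sumTo b (λ q → g (mirror J q))
      ≡⟨ sumTo-split c c (λ q → g (mirror J q)) ⟩
    sumTo c (λ q → g (mirror J q)) + sumTo c (λ n → g (mirror J (c + n)))
      ≡⟨ cong₂ _+_ (sumTo-cong c (λ q q<c → cong g (mirror-< {J} q<c)))
                   (sumTo-cong c (λ n _ → cong g (mirror-≥ {J} (m≤m+n c n)))) ⟩
    sumTo c (λ _ → g J) + sumTo c (λ _ → g (m′ ∸ J))
      ≡⟨ cong₂ _+_ (sumTo-const c (g J)) (sumTo-const c (g (m′ ∸ J))) ⟩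
    c * g J + c * g (m′ ∸ J)
      ≡⟨ *-distribˡ-+ c (g J) _ ⟨
    c * (g J + g (m′ ∸ J)) ∎

  pos : ℕ → ℕ → ℕ
  pos p q = q + p * b

  pos<ab : ∀ {p q} → p < a → q < b → pos p q < ab
  pos<ab p<a q<b = mixed-radix-< q<b p<a

  encode : ℕ → ℕ → ℕ → ℕ
  encode y X k = y + (X + k * ab) * 2m

  lowDigit : ℕ → ℕ → ℕ
  lowDigit d w = if d < t then w else m + (m′ ∸ w)

  midDigit : ℕ → ℕ → ℕ
  midDigit d P = if d < t then P else (ab ∸ 1) ∸ P

  topDigit : ℕ → ℕ
  topDigit d = if d < t then d else d ∸ t

  upperPart : ℕ → ℕ → ℕ
  upperPart d P = (midDigit d P + topDigit d * ab) * 2m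

  cellValue : ℕ → ℕ → ℕ → ℕ
  cellValue d w P = encode (lowDigit d w) (midDigit d P) (topDigit d)

  lowDigit-mirror : ∀ d {w} → w < m → lowDigit d w + lowDigit d (m′ ∸ w) ≡ lowDigit d 0 + lowDigit d m′
  lowDigit-mirror d {w} w<m = trans (complementary (<m⇒≤m′ w<m)) (sym (complementary z≤n))
    where
    regroup : ∀ m u v → m + u + (m + v) ≡ m + m + (v + u)
    regroup = solve-∀
    complementary : ∀ {v} → v ≤ m′ →
                    lowDigit d v + lowDigit d (m′ ∸ v) ≡ (if d < t then m′ else m + m + m′)
    complementary {v} v≤m′ = <-≥-cases d t
      (λ d<t → begin
        lowDigit d v + lowDigit d (m′ ∸ v)           ≡⟨ cong₂ _+_ (if-< d<t) (if-< d<t) ⟩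
        v + (m′ ∸ v)                                 ≡⟨ m+[n∸m]≡n v≤m′ ⟩
        m′                                           ≡⟨ if-< d<t ⟨
        (if d < t then m′ else m + m + m′)           ∎)
      (λ t≤d → begin
        lowDigit d v + lowDigit d (m′ ∸ v)           ≡⟨ cong₂ _+_ (if-≥ t≤d) (if-≥ t≤d) ⟩
        m + (m′ ∸ v) + (m + (m′ ∸ (m′ ∸ v)))         ≡⟨ cong (λ z → m + (m′ ∸ v) + (m + z)) (m∸[m∸n]≡n v≤m′) ⟩
        m + (m′ ∸ v) + (m + v)                       ≡⟨ regroup m (m′ ∸ v) v ⟩
        m + m + (v + (m′ ∸ v))                       ≡⟨ cong (m + m +_) (m+[n∸m]≡n v≤m′) ⟩
        m + m + m′                                   ≡⟨ if-≥ t≤d ⟨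
        (if d < t then m′ else m + m + m′)           ∎)

  <ab⇒≤ab∸1 : ∀ {P} → P < ab → P ≤ ab ∸ 1
  <ab⇒≤ab∸1 = s≤s⁻¹

  upperPairSum : ℕ → ℕ
  upperPairSum k = ((ab ∸ 1) + (k * ab + k * ab)) * 2m

  lowDigit-pair : ∀ {k w} → k < t → w < m → lowDigit k w + lowDigit (t + k) w ≡ m + m′
  lowDigit-pair {k} {w} k<t w<m = begin
    lowDigit k w + lowDigit (t + k) w   ≡⟨ cong₂ _+_ (if-< k<t) (if-≥ (m≤m+n t k)) ⟩
    w + (m + (m′ ∸ w))                  ≡⟨ x+[y+z]≡y+[x+z] w m (m′ ∸ w) ⟩
    m + (w + (m′ ∸ w))                  ≡⟨ cong (m +_) (m+[n∸m]≡n (<m⇒≤m′ w<m)) ⟩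
    m + m′                              ∎
    where
    x+[y+z]≡y+[x+z] : ∀ x y z → x + (y + z) ≡ y + (x + z)
    x+[y+z]≡y+[x+z] = solve-∀

  upperPart-pair : ∀ {k P} → k < t → P < ab → upperPart k P + upperPart (t + k) P ≡ upperPairSum k
  upperPart-pair {k} {P} k<t P<ab = begin
    upperPart k P + upperPart (t + k) P
      ≡⟨ cong₂ (λ X Y → (X + topDigit k * ab) * 2m + (Y + topDigit (t + k) * ab) * 2m) (if-< k<t) (if-≥ t≤t+k) ⟩
    (P + topDigit k * ab) * 2m + ((ab ∸ 1) ∸ P + topDigit (t + k) * ab) * 2m
      ≡⟨ cong₂ (λ i j → (P + i * ab) * 2m + ((ab ∸ 1) ∸ P + j * ab) * 2m) (if-< k<t) (trans (if-≥ t≤t+k) (m+n∸m≡n t k)) ⟩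
    (P + k * ab) * 2m + ((ab ∸ 1) ∸ P + k * ab) * 2m
      ≡⟨ collect P ((ab ∸ 1) ∸ P) (k * ab) 2m ⟩
    ((P + ((ab ∸ 1) ∸ P)) + (k * ab + k * ab)) * 2m
      ≡⟨ cong (λ z → (z + (k * ab + k * ab)) * 2m) (m+[n∸m]≡n (<ab⇒≤ab∸1 P<ab)) ⟩
    upperPairSum k ∎
    where
    t≤t+k : t ≤ t + k
    t≤t+k = m≤m+n t k
    collect : ∀ x y z w → (x + z) * w + (y + z) * w ≡ ((x + y) + (z + z)) * w
    collect = solve-∀

  cellValue-pair : ∀ {k w P} → k < t → w < m → P < ab →
                   cellValue k w P + cellValue (t + k) w P ≡ (m + m′) + upperPairSum k
  cellValue-pair {k} {w} {P} k<t w<m P<ab = begin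
    cellValue k w P + cellValue (t + k) w P
      ≡⟨ interchange (lowDigit k w) (upperPart k P) (lowDigit (t + k) w) (upperPart (t + k) P) ⟩
    (lowDigit k w + lowDigit (t + k) w) + (upperPart k P + upperPart (t + k) P)
      ≡⟨ cong₂ _+_ (lowDigit-pair k<t w<m) (upperPart-pair k<t P<ab) ⟩
    (m + m′) + upperPairSum k ∎
    where
    interchange : ∀ w x y z → (w + x) + (y + z) ≡ (w + y) + (x + z)
    interchange = solve-∀

  offsetFrom : ℕ → ℕ → ℕ
  offsetFrom y k = if y < m then k else t + k

  mirroredFrom : ℕ → ℕ
  mirroredFrom y = if y < m then y else m′ ∸ (y ∸ m)

  posFrom : ℕ → ℕ → ℕ
  posFrom y X = if y < m then X else (ab ∸ 1) ∸ X

  cellDigits-leftInverse : ∀ {d w P} → d < s → w < m → P < ab →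
                           (offsetFrom (lowDigit d w) (topDigit d) ≡ d) ×
                           (mirroredFrom (lowDigit d w) ≡ w) ×
                           (posFrom (lowDigit d w) (midDigit d P) ≡ P)
  cellDigits-leftInverse {d} {w} {P} d<s w<m P<ab = <-≥-cases d t first second
    where
    Recovered : Set
    Recovered = (offsetFrom (lowDigit d w) (topDigit d) ≡ d) ×
                (mirroredFrom (lowDigit d w) ≡ w) ×
                (posFrom (lowDigit d w) (midDigit d P) ≡ P)
    first : d < t → Recovered
    first d<t = trans (if-< y<m) (if-< d<t) , trans (if-< y<m) low≡ , trans (if-< y<m) (if-< d<t)
      where
      low≡ : lowDigit d w ≡ w
      low≡ = if-< d<t
      y<m : lowDigit d w < m
      y<m = subst (_< m) (sym low≡) w<m
    second : t ≤ d → Recovered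
    second t≤d =
      trans (if-≥ m≤y) (trans (cong (t +_) (if-≥ t≤d)) (m+[n∸m]≡n t≤d)) ,
      trans (if-≥ m≤y) (begin
        m′ ∸ (lowDigit d w ∸ m)    ≡⟨ cong (λ y → m′ ∸ (y ∸ m)) low≡ ⟩
        m′ ∸ (m + (m′ ∸ w) ∸ m)    ≡⟨ cong (m′ ∸_) (m+n∸m≡n m (m′ ∸ w)) ⟩
        m′ ∸ (m′ ∸ w)              ≡⟨ m∸[m∸n]≡n (<m⇒≤m′ w<m) ⟩
        w                          ∎) ,
      trans (if-≥ m≤y) (trans (cong ((ab ∸ 1) ∸_) (if-≥ t≤d)) (m∸[m∸n]≡n (<ab⇒≤ab∸1 P<ab)))
      where
      low≡ : lowDigit d w ≡ m + (m′ ∸ w)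
      low≡ = if-≥ t≤d
      m≤y : m ≤ lowDigit d w
      m≤y = subst (m ≤_) (sym low≡) (m≤m+n m (m′ ∸ w))

  cellValue-low : ∀ {d w P} → d < t → cellValue d w P ≡ encode w P d
  cellValue-low d<t = cong₃ encode (if-< d<t) (if-< d<t) (if-< d<t)

  cellValue-high : ∀ {d w P} → t ≤ d → cellValue d w P ≡ encode (m + (m′ ∸ w)) ((ab ∸ 1) ∸ P) (d ∸ t)
  cellValue-high t≤d = cong₃ encode (if-≥ t≤d) (if-≥ t≤d) (if-≥ t≤d)

  cellDigits-rightInverse : ∀ {y X k} → y < 2m → X < ab → k < t →
                            (offsetFrom y k < s) × (mirroredFrom y < m) × (posFrom y X < ab) ×
                            (cellValue (offsetFrom y k) (mirroredFrom y) (posFrom y X) ≡ encode y X k)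
  cellDigits-rightInverse {y} {X} {k} y<2m X<ab k<t = <-≥-cases y m first second
    where
    first : y < m → (offsetFrom y k < s) × (mirroredFrom y < m) × (posFrom y X < ab) ×
                    (cellValue (offsetFrom y k) (mirroredFrom y) (posFrom y X) ≡ encode y X k)
    first y<m =
      subst (_< s) (sym (if-< y<m)) (≤-trans k<t (m≤m+n t t)) ,
      subst (_< m) (sym (if-< y<m)) y<m ,
      subst (_< ab) (sym (if-< y<m)) X<ab ,
      trans (cong₃ cellValue (if-< y<m) (if-< y<m) (if-< y<m)) (cellValue-low k<t)
    second : m ≤ y → (offsetFrom y k < s) × (mirroredFrom y < m) × (posFrom y X < ab) ×
                     (cellValue (offsetFrom y k) (mirroredFrom y) (posFrom y X) ≡ encode y X k)
    second m≤y =
      subst (_< s) (sym (if-≥ m≤y)) (+-monoʳ-< t k<t) ,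
      subst (_< m) (sym (if-≥ m≤y)) (s≤s (m∸n≤m m′ (y ∸ m))) ,
      subst (_< ab) (sym (if-≥ m≤y)) (s≤s (m∸n≤m (ab ∸ 1) X)) ,
      (begin
        cellValue (offsetFrom y k) (mirroredFrom y) (posFrom y X)
          ≡⟨ cong₃ cellValue (if-≥ m≤y) (if-≥ m≤y) (if-≥ m≤y) ⟩
        cellValue (t + k) (m′ ∸ (y ∸ m)) ((ab ∸ 1) ∸ X)
          ≡⟨ cellValue-high (m≤m+n t k) ⟩
        encode (m + (m′ ∸ (m′ ∸ (y ∸ m)))) ((ab ∸ 1) ∸ ((ab ∸ 1) ∸ X)) (t + k ∸ t)
          ≡⟨ cong₃ encode low≡ (m∸[m∸n]≡n (<ab⇒≤ab∸1 X<ab)) (m+n∸m≡n t k) ⟩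
        encode y X k ∎)
      where
      y∸m<m : y ∸ m < m
      y∸m<m = subst (y ∸ m <_) (m+n∸m≡n m m) (∸-monoˡ-< y<2m m≤y)
      low≡ : m + (m′ ∸ (m′ ∸ (y ∸ m))) ≡ y
      low≡ = trans (cong (m +_) (m∸[m∸n]≡n (<m⇒≤m′ y∸m<m))) (m+[n∸m]≡n m≤y)

  N : ℕ
  N = t * ab * 2m

  lowOf midOf topOf : ℕ → ℕ
  lowOf x = x % 2m
  midOf x = x / 2m % ab
  topOf x = x / 2m / ab

  encode-< : ∀ {y X k} → y < 2m → X < ab → k < t → encode y X k < N
  encode-< y<2m X<ab k<t = mixed-radix-< y<2m (mixed-radix-< X<ab k<t)

  decode-encode : ∀ {y X} k → y < 2m → X < ab →
                  (lowOf (encode y X k) ≡ y) × (midOf (encode y X k) ≡ X) × (topOf (encode y X k) ≡ k)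
  decode-encode {y} {X} k y<2m X<ab =
    proj₂ outer ,
    trans (cong (_% ab) (proj₁ outer)) (proj₂ inner) ,
    trans (cong (_/ ab) (proj₁ outer)) (proj₁ inner)
    where
    outer : (encode y X k / 2m ≡ X + k * ab) × (lowOf (encode y X k) ≡ y)
    outer = divmod-unique (X + k * ab) y<2m
    inner : ((X + k * ab) / ab ≡ k) × ((X + k * ab) % ab ≡ X)
    inner = divmod-unique k X<ab

  encode-decode : ∀ x → encode (lowOf x) (midOf x) (topOf x) ≡ x
  encode-decode x =
    trans (cong (λ z → lowOf x + z * 2m) (sym (m≡m%n+[m/n]*n (x / 2m) ab))) (sym (m≡m%n+[m/n]*n x 2m))

  decode-< : ∀ {x} → x < N → (lowOf x < 2m) × (midOf x < ab) × (topOf x < t)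
  decode-< {x} x<N = m%n<n x 2m , m%n<n (x / 2m) ab , m<n*o⇒m/o<n (m<n*o⇒m/o<n x<N)

  lowDigit<2m : ∀ d {w} → w < m → lowDigit d w < 2m
  lowDigit<2m d {w} w<m =
    if-elim (_< 2m) d t (λ _ → ≤-trans w<m (m≤m+n m m)) (λ _ → +-monoʳ-< m (s≤s (m∸n≤m m′ w)))

  midDigit<ab : ∀ d {P} → P < ab → midDigit d P < ab
  midDigit<ab d {P} P<ab = if-elim (_< ab) d t (λ _ → P<ab) (λ _ → s≤s (m∸n≤m (ab ∸ 1) P))

  topDigit<t : ∀ {d} → d < s → topDigit d < t
  topDigit<t {d} d<s =
    if-elim (_< t) d t id (λ t≤d → subst (d ∸ t <_) (m+n∸m≡n t t) (∸-monoˡ-< d<s t≤d))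

  cellValue<N : ∀ {d w P} → d < s → w < m → P < ab → cellValue d w P < N
  cellValue<N {d} d<s w<m P<ab = encode-< (lowDigit<2m d w<m) (midDigit<ab d P<ab) (topDigit<t d<s)

  offsetOf mirroredOf posOf : ℕ → ℕ
  offsetOf x = offsetFrom (lowOf x) (topOf x)
  mirroredOf x = mirroredFrom (lowOf x)
  posOf x = posFrom (lowOf x) (midOf x)

  decode-cellValue : ∀ {d w P} → d < s → w < m → P < ab →
                     (offsetOf (cellValue d w P) ≡ d) × (mirroredOf (cellValue d w P) ≡ w) ×
                     (posOf (cellValue d w P) ≡ P)
  decode-cellValue {d} {w} {P} d<s w<m P<ab =
    let (low≡ , mid≡ , top≡) = decode-encode (topDigit d) (lowDigit<2m d w<m) (midDigit<ab d P<ab)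
        (d≡ , w≡ , P≡)       = cellDigits-leftInverse d<s w<m P<ab
    in trans (cong₂ offsetFrom low≡ top≡) d≡ ,
       trans (cong mirroredFrom low≡) w≡ ,
       trans (cong₂ posFrom low≡ mid≡) P≡

  cellValue-decode : ∀ {x} → x < N →
                     (offsetOf x < s) × (mirroredOf x < m) × (posOf x < ab) ×
                     (cellValue (offsetOf x) (mirroredOf x) (posOf x) ≡ x)
  cellValue-decode {x} x<N =
    let (low< , mid< , top<) = decode-< x<N
        (d< , w< , P< , value≡) = cellDigits-rightInverse low< mid< top<
    in d< , w< , P< , trans value≡ (encode-decode x)

  block : ℕ → ℕ → ℕ → ℕ → Maybe ℕ
  block I p J q = if J ⊖ I < s then just (cellValue (J ⊖ I) (mirror J q) (pos p q)) else nothing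

  block-filled : ∀ {I p J q} → J ⊖ I < s → block I p J q ≡ just (cellValue (J ⊖ I) (mirror J q) (pos p q))
  block-filled = if-<

  entry-block : ∀ I p J q →
                entry (block I p J q) ≡ (if J ⊖ I < s then cellValue (J ⊖ I) (mirror J q) (pos p q) else 0)
  entry-block I p J q = if-map entry (J ⊖ I) s _ nothing

  filled-block : ∀ I p J q → filled (block I p J q) ≡ (if J ⊖ I < s then 1 else 0)
  filled-block I p J q = if-map filled (J ⊖ I) s _ nothing

  sumTo-filled : ∀ n d → sumTo n (λ _ → if d < s then 1 else 0) ≡ (if d < s then n else 0)
  sumTo-filled n d = trans (sumTo-if n d s (λ _ → 1))
                           (cong (λ v → if d < s then v else 0) (trans (sumTo-const n 1) (*-identityʳ n)))

  rowWeight : ℕ → ℕ → ℕ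
  rowWeight p d = c * (lowDigit d 0 + lowDigit d m′) + sumTo b (λ q → upperPart d (pos p q))

  sumTo-row-block : ∀ {J} d p → J < m → sumTo b (λ q → cellValue d (mirror J q) (pos p q)) ≡ rowWeight p d
  sumTo-row-block {J} d p J<m = begin
    sumTo b (λ q → lowDigit d (mirror J q) + upperPart d (pos p q))
      ≡⟨ sumTo-+ b (λ q → lowDigit d (mirror J q)) (λ q → upperPart d (pos p q)) ⟩
    sumTo b (λ q → lowDigit d (mirror J q)) + sumTo b (λ q → upperPart d (pos p q))
      ≡⟨ cong (_+ sumTo b (λ q → upperPart d (pos p q))) (sumTo-mirror J (lowDigit d)) ⟩
    c * (lowDigit d J + lowDigit d (m′ ∸ J)) + sumTo b (λ q → upperPart d (pos p q))
      ≡⟨ cong (λ z → c * z + sumTo b (λ q → upperPart d (pos p q))) (lowDigit-mirror d J<m) ⟩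
    rowWeight p d ∎

  rowMagicSum : ℕ
  rowMagicSum = sumTo s (λ d → c * (lowDigit d 0 + lowDigit d m′)) + sumTo t (λ k → b * upperPairSum k)

  sumTo-upperPart : ∀ {p} → p < a →
                    sumTo s (λ d → sumTo b (λ q → upperPart d (pos p q))) ≡ sumTo t (λ k → b * upperPairSum k)
  sumTo-upperPart {p} p<a = trans (sumTo-halves t (λ d → sumTo b (λ q → upperPart d (pos p q)))) (sumTo-cong t pair)
    where
    pair : ∀ k → k < t →
           sumTo b (λ q → upperPart k (pos p q)) + sumTo b (λ q → upperPart (t + k) (pos p q)) ≡ b * upperPairSum k
    pair k k<t = trans (sym (sumTo-+ b (λ q → upperPart k (pos p q)) (λ q → upperPart (t + k) (pos p q))))
                       (trans (sumTo-cong b (λ q q<b → upperPart-pair k<t (pos<ab p<a q<b))) (sumTo-const b (upperPairSum k)))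

  row-sum : ∀ {I p} → I < m → p < a → sumTo m (λ J → sumTo b (λ q → entry (block I p J q))) ≡ rowMagicSum
  row-sum {I} {p} I<m p<a = begin
    sumTo m (λ J → sumTo b (λ q → entry (block I p J q)))
      ≡⟨ sumTo-cong m segment ⟩
    sumTo m (λ J → if J ⊖ I < s then rowWeight p (J ⊖ I) else 0)
      ≡⟨ sumTo-rotate I<m (λ d → if d < s then rowWeight p d else 0) ⟩
    sumTo m (λ d → if d < s then rowWeight p d else 0)
      ≡⟨ sumTo-guard (rowWeight p) s≤m ⟩
    sumTo s (rowWeight p)
      ≡⟨ sumTo-+ s (λ d → c * (lowDigit d 0 + lowDigit d m′)) (λ d → sumTo b (λ q → upperPart d (pos p q))) ⟩
    sumTo s (λ d → c * (lowDigit d 0 + lowDigit d m′)) + sumTo s (λ d → sumTo b (λ q → upperPart d (pos p q)))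
      ≡⟨ cong (sumTo s (λ d → c * (lowDigit d 0 + lowDigit d m′)) +_) (sumTo-upperPart p<a) ⟩
    rowMagicSum ∎
    where
    segment : ∀ J → J < m →
              sumTo b (λ q → entry (block I p J q)) ≡ (if J ⊖ I < s then rowWeight p (J ⊖ I) else 0)
    segment J J<m = begin
      sumTo b (λ q → entry (block I p J q))
        ≡⟨ sumTo-cong b (λ q _ → entry-block I p J q) ⟩
      sumTo b (λ q → if J ⊖ I < s then cellValue (J ⊖ I) (mirror J q) (pos p q) else 0)
        ≡⟨ sumTo-if b (J ⊖ I) s (λ q → cellValue (J ⊖ I) (mirror J q) (pos p q)) ⟩
      (if J ⊖ I < s then sumTo b (λ q → cellValue (J ⊖ I) (mirror J q) (pos p q)) else 0)
        ≡⟨ cong (λ v → if J ⊖ I < s then v else 0) (sumTo-row-block (J ⊖ I) p J<m) ⟩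
      (if J ⊖ I < s then rowWeight p (J ⊖ I) else 0) ∎

  colMagicSum : ℕ
  colMagicSum = sumTo t (λ k → a * ((m + m′) + upperPairSum k))

  col-sum : ∀ {J q} → J < m → q < b → sumTo m (λ I → sumTo a (λ p → entry (block I p J q))) ≡ colMagicSum
  col-sum {J} {q} J<m q<b = begin
    sumTo m (λ I → sumTo a (λ p → entry (block I p J q)))
      ≡⟨ sumTo-cong m (λ I _ → trans (sumTo-cong a (λ p _ → entry-block I p J q)) (sumTo-if a (J ⊖ I) s (G′ (J ⊖ I)))) ⟩
    sumTo m (λ I → if J ⊖ I < s then G (J ⊖ I) else 0)
      ≡⟨ sumTo-reflect J<m (λ d → if d < s then G d else 0) ⟩
    sumTo m (λ d → if d < s then G d else 0)
      ≡⟨ sumTo-guard G s≤m ⟩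
    sumTo s G
      ≡⟨ sumTo-halves t G ⟩
    sumTo t (λ k → G k + G (t + k))
      ≡⟨ sumTo-cong t pair ⟩
    colMagicSum ∎
    where
    G′ : ℕ → ℕ → ℕ
    G′ d p = cellValue d (mirror J q) (pos p q)
    G : ℕ → ℕ
    G d = sumTo a (G′ d)
    pair : ∀ k → k < t → G k + G (t + k) ≡ a * ((m + m′) + upperPairSum k)
    pair k k<t = trans (sym (sumTo-+ a (G′ k) (G′ (t + k))))
      (trans (sumTo-cong a (λ p p<a → cellValue-pair k<t (mirror<m q J<m) (pos<ab p<a q<b))) (sumTo-const a _))

  row-count : ∀ {I} p → I < m → sumTo m (λ J → sumTo b (λ q → filled (block I p J q))) ≡ b * s
  row-count {I} p I<m = begin
    sumTo m (λ J → sumTo b (λ q → filled (block I p J q)))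
      ≡⟨ sumTo-cong m (λ J _ → trans (sumTo-cong b (λ q _ → filled-block I p J q)) (sumTo-filled b (J ⊖ I))) ⟩
    sumTo m (λ J → if J ⊖ I < s then b else 0)
      ≡⟨ sumTo-rotate I<m (λ d → if d < s then b else 0) ⟩
    sumTo m (λ d → if d < s then b else 0)
      ≡⟨ sumTo-guard (λ _ → b) s≤m ⟩
    sumTo s (λ _ → b)
      ≡⟨ trans (sumTo-const s b) (*-comm s b) ⟩
    b * s ∎

  col-count : ∀ {J} q → J < m → sumTo m (λ I → sumTo a (λ p → filled (block I p J q))) ≡ a * s
  col-count {J} q J<m = begin
    sumTo m (λ I → sumTo a (λ p → filled (block I p J q)))
      ≡⟨ sumTo-cong m (λ I _ → trans (sumTo-cong a (λ p _ → filled-block I p J q)) (sumTo-filled a (J ⊖ I))) ⟩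
    sumTo m (λ I → if J ⊖ I < s then a else 0)
      ≡⟨ sumTo-reflect J<m (λ d → if d < s then a else 0) ⟩
    sumTo m (λ d → if d < s then a else 0)
      ≡⟨ sumTo-guard (λ _ → a) s≤m ⟩
    sumTo s (λ _ → a)
      ≡⟨ trans (sumTo-const s a) (*-comm s a) ⟩
    a * s ∎

  blockColOf rowOf colOf : ℕ → ℕ
  blockColOf x = mirror (mirroredOf x) (posOf x % b)
  rowOf x = posOf x / b + (blockColOf x ⊖ offsetOf x) * a
  colOf x = posOf x % b + blockColOf x * b

  coordinates-cellValue : ∀ {I p J q} → I < m → p < a → J < m → q < b → J ⊖ I < s →
                          (rowOf (cellValue (J ⊖ I) (mirror J q) (pos p q)) ≡ p + I * a) ×
                          (colOf (cellValue (J ⊖ I) (mirror J q) (pos p q)) ≡ q + J * b)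
  coordinates-cellValue {I} {p} {J} {q} I<m p<a J<m q<b d<s =
    cong₂ (λ p′ I′ → p′ + I′ * a) p≡ I≡ , cong₂ (λ q′ J′ → q′ + J′ * b) q≡ J≡
    where
    x : ℕ
    x = cellValue (J ⊖ I) (mirror J q) (pos p q)
    decoded : (offsetOf x ≡ J ⊖ I) × (mirroredOf x ≡ mirror J q) × (posOf x ≡ pos p q)
    decoded = decode-cellValue d<s (mirror<m q J<m) (pos<ab p<a q<b)
    q≡ : posOf x % b ≡ q
    q≡ = trans (cong (_% b) (proj₂ (proj₂ decoded))) (proj₂ (divmod-unique p q<b))
    p≡ : posOf x / b ≡ p
    p≡ = trans (cong (_/ b) (proj₂ (proj₂ decoded))) (proj₁ (divmod-unique p q<b))
    J≡ : blockColOf x ≡ J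
    J≡ = trans (cong₂ mirror (proj₁ (proj₂ decoded)) q≡) (mirror-involutive q J<m)
    I≡ : blockColOf x ⊖ offsetOf x ≡ I
    I≡ = trans (cong₂ _⊖_ J≡ (proj₁ decoded)) (⊖-cancel J<m I<m)

  array : Array (a * m) (b * m)
  array i j = block (toℕ i / a) (toℕ i % a) (toℕ j / b) (toℕ j % b)

  split-index : ∀ k .{{_ : NonZero k}} {n} → n < k * m → (n / k < m) × (n % k < k)
  split-index k {n} n<km = m<n*o⇒m/o<n (subst (n <_) (*-comm k m) n<km) , m%n<n n k

  array-block : ∀ {i j I p J q} → p < a → q < b → toℕ i ≡ p + I * a → toℕ j ≡ q + J * b →
                array i j ≡ block I p J q
  array-block {i} {j} {I} {p} {J} {q} p<a q<b i≡ j≡ =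
    cong₂ (λ (I′ , p′) (J′ , q′) → block I′ p′ J′ q′) row col
    where
    row : (toℕ i / a , toℕ i % a) ≡ (I , p)
    row = trans (cong (λ n → n / a , n % a) i≡) (uncurry (cong₂ _,_) (divmod-unique I p<a))
    col : (toℕ j / b , toℕ j % b) ≡ (J , q)
    col = trans (cong (λ n → n / b , n % b) j≡) (uncurry (cong₂ _,_) (divmod-unique J q<b))

  block-just : ∀ {I p J q x} → I < m → p < a → J < m → q < b → block I p J q ≡ just x →
               (x < N) × (rowOf x ≡ p + I * a) × (colOf x ≡ q + J * b)
  block-just {I} {p} {J} {q} {x} I<m p<a J<m q<b block≡x =
    subst (_< N) value≡ (cellValue<N d<s (mirror<m q J<m) (pos<ab p<a q<b)) ,
    trans (cong rowOf (sym value≡)) (proj₁ coordinates) ,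
    trans (cong colOf (sym value≡)) (proj₂ coordinates)
    where
    d<s : J ⊖ I < s
    d<s = proj₁ (if-just {J ⊖ I} {s} block≡x)
    value≡ : cellValue (J ⊖ I) (mirror J q) (pos p q) ≡ x
    value≡ = proj₂ (if-just {J ⊖ I} {s} block≡x)
    coordinates : (rowOf (cellValue (J ⊖ I) (mirror J q) (pos p q)) ≡ p + I * a) ×
                  (colOf (cellValue (J ⊖ I) (mirror J q) (pos p q)) ≡ q + J * b)
    coordinates = coordinates-cellValue I<m p<a J<m q<b d<s

  array-just : ∀ {i j x} → array i j ≡ just x → (x < N) × (rowOf x ≡ toℕ i) × (colOf x ≡ toℕ j)
  array-just {i} {j} {x} array≡x =
    proj₁ found ,
    trans (proj₁ (proj₂ found)) (sym (m≡m%n+[m/n]*n (toℕ i) a)) ,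
    trans (proj₂ (proj₂ found)) (sym (m≡m%n+[m/n]*n (toℕ j) b))
    where
    found : (x < N) × (rowOf x ≡ toℕ i % a + (toℕ i / a) * a) × (colOf x ≡ toℕ j % b + (toℕ j / b) * b)
    found = block-just (proj₁ (split-index a (toℕ<n i))) (proj₂ (split-index a (toℕ<n i)))
                       (proj₁ (split-index b (toℕ<n j))) (proj₂ (split-index b (toℕ<n j))) array≡x

  block-decoded : ∀ {d w P} → d < s → w < m →
                  block (mirror w (P % b) ⊖ d) (P / b) (mirror w (P % b)) (P % b) ≡ just (cellValue d w P)
  block-decoded {d} {w} {P} d<s w<m = begin
    block (J ⊖ d) (P / b) J (P % b)
      ≡⟨ block-filled {J ⊖ d} {P / b} {J} {P % b} (subst (_< s) (sym J⊖[J⊖d]≡d) d<s) ⟩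
    just (cellValue (J ⊖ (J ⊖ d)) (mirror J (P % b)) (pos (P / b) (P % b)))
      ≡⟨ cong just (cong₃ cellValue J⊖[J⊖d]≡d (mirror-involutive (P % b) w<m) (sym (m≡m%n+[m/n]*n P b))) ⟩
    just (cellValue d w P) ∎
    where
    J : ℕ
    J = mirror w (P % b)
    J⊖[J⊖d]≡d : J ⊖ (J ⊖ d) ≡ d
    J⊖[J⊖d]≡d = ⊖-cancel (mirror<m (P % b) w<m) (<-≤-trans d<s s≤m)

  array-decode : ∀ {x} → x < N → ∃[ i ] ∃[ j ] (array i j ≡ just x)
  array-decode {x} x<N = fromℕ< row< , fromℕ< col< ,
    trans (array-block {I = I} {p} {J} {q} p<a q<b (toℕ-fromℕ< row<) (toℕ-fromℕ< col<))
          (trans (block-decoded d<s w<m) (cong just value≡))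
    where
    decoded : (offsetOf x < s) × (mirroredOf x < m) × (posOf x < ab) ×
              (cellValue (offsetOf x) (mirroredOf x) (posOf x) ≡ x)
    decoded = cellValue-decode x<N
    d<s : offsetOf x < s
    d<s = proj₁ decoded
    w<m : mirroredOf x < m
    w<m = proj₁ (proj₂ decoded)
    P<ab : posOf x < ab
    P<ab = proj₁ (proj₂ (proj₂ decoded))
    value≡ : cellValue (offsetOf x) (mirroredOf x) (posOf x) ≡ x
    value≡ = proj₂ (proj₂ (proj₂ decoded))
    q p J I : ℕ
    q = posOf x % b
    p = posOf x / b
    J = blockColOf x
    I = J ⊖ offsetOf x
    q<b : q < b
    q<b = m%n<n (posOf x) b
    p<a : p < a
    p<a = m<n*o⇒m/o<n P<ab
    J<m : J < m
    J<m = mirror<m q w<m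
    row< : rowOf x < a * m
    row< = subst (rowOf x <_) (*-comm m a) (mixed-radix-< p<a (⊖<m J<m (<-≤-trans d<s s≤m)))
    col< : colOf x < b * m
    col< = subst (colOf x <_) (*-comm m b) (mixed-radix-< q<b J<m)

  size : a * m * (b * s) ≡ N
  size = shape a b m t
    where
    shape : ∀ a b m t → a * m * (b * (t + t)) ≡ t * (a * b) * (m + m)
    shape = solve-∀

  row-entries : ∀ i → Σℕ (λ j → entry (array i j)) ≡ rowMagicSum
  row-entries i = trans (Σℕ-blocks b m (λ J q → entry (block (toℕ i / a) (toℕ i % a) J q)))
                        (row-sum (proj₁ (split-index a (toℕ<n i))) (proj₂ (split-index a (toℕ<n i))))

  col-entries : ∀ j → Σℕ (λ i → entry (array i j)) ≡ colMagicSum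
  col-entries j = trans (Σℕ-blocks a m (λ I p → entry (block I p (toℕ j / b) (toℕ j % b))))
                        (col-sum (proj₁ (split-index b (toℕ<n j))) (proj₂ (split-index b (toℕ<n j))))

  isMagicRectangle : IsMagicRectangle (a * m) (b * m) (b * s) (a * s) array
  isMagicRectangle = record
    { rowFilled = λ i → trans (Σℕ-blocks b m (λ J q → filled (block (toℕ i / a) (toℕ i % a) J q)))
                              (row-count (toℕ i % a) (proj₁ (split-index a (toℕ<n i))))
    ; colFilled = λ j → trans (Σℕ-blocks a m (λ I p → filled (block I p (toℕ j / b) (toℕ j % b))))
                              (col-count (toℕ j % b) (proj₁ (split-index b (toℕ<n j))))
    ; entries<  = λ i j x array≡x → subst (x <_) (sym size) (proj₁ (array-just {i} {j} array≡x))
    ; occurs    = λ x x< → array-decode (subst (x <_) size x<)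
    ; once      = λ i j i′ j′ x array≡x array′≡x →
        let (_ , row≡ , col≡)   = array-just {i} {j} array≡x
            (_ , row′≡ , col′≡) = array-just {i′} {j′} array′≡x
        in toℕ-injective (trans (sym row≡) row′≡) , toℕ-injective (trans (sym col≡) col′≡)
    ; rowSums   = λ i i′ → trans (row-entries i) (sym (row-entries i′))
    ; colSums   = λ j j′ → trans (col-entries j) (sym (col-entries j′))
    }

transposed-size : ∀ a b m s → a * m * (b * s) ≡ b * m * (a * s)
transposed-size = solve-∀

MR-transpose-⇔ : ∀ a b m s → MR (a * m) (b * m) (b * s) (a * s) ⇔ MR (b * m) (a * m) (a * s) (b * s)
MR-transpose-⇔ a b m s =
  mk⇔ (MR-transpose (transposed-size a b m s)) (MR-transpose (transposed-size b a m s))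

even⇒double : ∀ {n} .{{_ : NonZero n}} → 2 ∣ n → ∃[ k ] n ≡ suc k + suc k
even⇒double {n} (divides zero n≡0)    = contradiction n≡0 (≢-nonZero⁻¹ n)
even⇒double     (divides (suc k) refl) = k , double (suc k)
  where
  double : ∀ k → k * 2 ≡ k + k
  double = solve-∀

MR-exists : ∀ a m {b s} .{{_ : NonZero a}} .{{_ : NonZero m}} .{{_ : NonZero b}} .{{_ : NonZero s}} →
            2 ∣ b → 2 ∣ s → s ≤ m → MR (a * m) (b * m) (b * s) (a * s)
MR-exists (suc a′) (suc m′) 2∣b 2∣s s≤m with even⇒double 2∣b | even⇒double 2∣s
... | c′ , refl | t′ , refl = array , isMagicRectangle
  where open Construction a′ c′ m′ t′ s≤m

MR-characterisation : ∀ a b m s .{{_ : NonZero a}} .{{_ : NonZero b}} .{{_ : NonZero m}} .{{_ : NonZero s}} →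
                      ¬ 2 ∣ a → 2 ∣ b → MR (a * m) (b * m) (b * s) (a * s) ⇔ ((2 ∣ s) × (2 ≤ s) × (s ≤ m))
MR-characterisation a b m s 2∤a 2∣b = mk⇔ necessary (λ (2∣s , _ , s≤m) → MR-exists a m 2∣b 2∣s s≤m)
  where
  instance
    _ : NonZero (a * m)
    _ = m*n≢0 a m
    _ : NonZero (b * m)
    _ = m*n≢0 b m
  necessary : MR (a * m) (b * m) (b * s) (a * s) → (2 ∣ s) × (2 ≤ s) × (s ≤ m)
  necessary (A , H) = 2∣s , ∣⇒≤ 2∣s , *-cancelˡ-≤ b (row-length-≤ H)
    where
    2∣as : 2 ∣ a * s
    2∣as = row-length-even (transpose (transposed-size a b m s) H) (∣m⇒∣m*n (a * s) (∣m⇒∣m*n m 2∣b))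
    2∣s : 2 ∣ s
    2∣s = [ (λ 2∣a → contradiction 2∣a 2∤a) , id ]′ (euclidsLemma a s prime[2] 2∣as)

theorem12 : (a b m s : ℕ) → .{{NonZero a}} → .{{NonZero b}} →
    .{{NonZero m}} → .{{NonZero s}} → a + b ≡ 5 →
    MR (a * m) (b * m) (b * s) (a * s) ⇔ ((2 ∣ s) × (2 ≤ s) × (s ≤ m))
theorem12 0 b m s _ = contradiction refl (≢-nonZero⁻¹ 0)
theorem12 1 .4 m s refl = MR-characterisation 1 4 m s (from-no (2 ∣? 1)) (divides 2 refl)
theorem12 2 .3 m s refl = MR-characterisation 3 2 m s (from-no (2 ∣? 3)) (divides 1 refl) ⇔-∘ MR-transpose-⇔ 2 3 m s
theorem12 3 .2 m s refl = MR-characterisation 3 2 m s (from-no (2 ∣? 3)) (divides 1 refl)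
theorem12 4 .1 m s refl = MR-characterisation 1 4 m s (from-no (2 ∣? 1)) (divides 2 refl) ⇔-∘ MR-transpose-⇔ 4 1 m s
theorem12 5 .0 m s refl = contradiction refl (≢-nonZero⁻¹ 0)
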